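{- Let $D$ be a skew Ferrers diagram. Then the noncrossing alternating triangulation of $Q_{G_D}$ is a regular triangulation. This is the triangulation whose maximal simplices are the $Q_F$, as $F$ ranges over the noncrossing alternating spanning forests of $G_D$ with $|V(G_D)|-k$ edges, where $k$ is the number of connected components of $G_D$.
   Context: Boxes are indexed by (row, column), rows numbered from top to bottom and columns from left to right. A skew Ferrers diagram is a set of boxes $\lambda\setminus\mu$ for partitions $\mu\subseteq\lambda$. For $D$ with $r$ rows and $c$ columns, label its rows $1,\dots,r$ from top to bottom and its columns $1,\dots,c$ from left to right. Let $G_D$ be the bipartite graph with vertices $x_1,\dots,x_r,y_1,\dots,y_c$ and edges $(x_i,y_j)$ for $(i,j)\in D$. Its vertices are drawn on a line in the left-to-right order $x_r,\dots,x_1,y_c,\dots,y_1$, with edges oriented left to right. A subgraph is noncrossing if it has no edges $(v_i,v_k)$, $(v_j,v_l)$ with $i<j<k<l$ in this order. A vertex is alternating unless it has both incoming and outgoing edges; a subgraph is alternating if all its vertices are. For a subgraph $H$, let $Q_H=\mathrm{ConvHull}(e_i-e_{r+j} : (x_i,y_j)\in E(H))\subset\mathbb{R}^{r+c}$. It is known that the polytopes $Q_F$ above are interior-disjoint simplices of full dimension whose union is $Q_{G_D}$. A triangulation of a polytope $P$ is regular if there exists a concave piecewise linear function $f:P\to\mathbb{R}$ whose maximal regions of linearity are exactly the maximal simplices of the triangulation. -}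

module Defs where

open import Data.Nat as ℕ using (ℕ; zero; suc)
open import Data.Fin as Fin using (Fin; zero; suc; toℕ; inject₁; fromℕ; _↑ˡ_; _↑ʳ_)
open import Data.Fin.Properties using () renaming (_≟_ to _≟ᶠ_)
open import Data.Bool using (Bool; true; false; if_then_else_)
open import Data.Sum using (_⊎_; inj₁; inj₂)
open import Data.Product using (Σ; ∃; _×_; _,_)
open import Data.Rational as ℚ using (ℚ; 0ℚ; 1ℚ)
open import Relation.Binary.PropositionalEquality using (_≡_)
open import Relation.Nullary using (¬_; yes; no)
open import Function.Definitions using (Injective)

sumℕ : (n : ℕ) → (Fin n → ℕ) → ℕ
sumℕ zero    f = 0
sumℕ (suc n) f = f zero ℕ.+ sumℕ n (λ k → f (suc k))

sumℚ : (n : ℕ) → (Fin n → ℚ) → ℚ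
sumℚ zero    f = 0ℚ
sumℚ (suc n) f = f zero ℚ.+ sumℚ n (λ k → f (suc k))

-- Rows and columns are 0-indexed here: row i : Fin r is row (i+1) of
-- the paper (counted top to bottom), column j : Fin c is column (j+1).
-- λ, μ are the first r parts of the partitions (weakly decreasing).

record SkewDiagram (r c : ℕ) : Set where
  field
    lam mu     : Fin r → ℕ
    lam-decr   : ∀ (i i' : Fin r) → toℕ i ℕ.≤ toℕ i' → lam i' ℕ.≤ lam i
    mu-decr    : ∀ (i i' : Fin r) → toℕ i ℕ.≤ toℕ i' → mu i' ℕ.≤ mu i
    mu≤lam     : ∀ (i : Fin r) → mu i ℕ.≤ lam i
    lam≤c      : ∀ (i : Fin r) → lam i ℕ.≤ c

Box : ∀ {r c} → SkewDiagram r c → Fin r → Fin c → Set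
Box D i j = SkewDiagram.mu D i ℕ.≤ toℕ j × toℕ j ℕ.< SkewDiagram.lam D i

-- D has exactly r rows and c columns: every row and column is occupied.
HasRowsCols : ∀ {r c} → SkewDiagram r c → Set
HasRowsCols {r} {c} D =
  (∀ (i : Fin r) → ∃ λ (j : Fin c) → Box D i j) ×
  (∀ (j : Fin c) → ∃ λ (i : Fin r) → Box D i j)

-- The bipartite graph G_D.  Vertices: inj₁ i = x_{i+1}, inj₂ j = y_{j+1}.

Vertex : ℕ → ℕ → Set
Vertex r c = Fin r ⊎ Fin c

-- Position on the line  x_r, …, x_1, y_c, …, y_1  (0-based).
pos : ∀ {r c} → Vertex r c → ℕ
pos {r} {c} (inj₁ i) = r ℕ.∸ suc (toℕ i)
pos {r} {c} (inj₂ j) = r ℕ.+ (c ℕ.∸ suc (toℕ j))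

-- A subgraph (spanning, on all vertices of G_D) given by its edge set.
Subgraph : ℕ → ℕ → Set
Subgraph r c = Fin r → Fin c → Bool

Edge : ∀ {r c} → Subgraph r c → Fin r → Fin c → Set
Edge H i j = H i j ≡ true

IsSubgraphOf : ∀ {r c} → Subgraph r c → SkewDiagram r c → Set
IsSubgraphOf {r} {c} H D = ∀ (i : Fin r) (j : Fin c) → Edge H i j → Box D i j

numEdges : ∀ {r c} → Subgraph r c → ℕ
numEdges {r} {c} H =
  sumℕ r (λ i → sumℕ c (λ j → if H i j then 1 else 0))

-- Edge (x_i, y_j) drawn as the arc between its two endpoints; oriented
-- from the endpoint with smaller position to the one with larger position.
tailV headV : ∀ {r c} → Fin r → Fin c → Vertex r c
tailV {r} {c} i j with pos {r} {c} (inj₁ i) ℕ.<? pos {r} {c} (inj₂ j)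
... | yes _ = inj₁ i
... | no  _ = inj₂ j
headV {r} {c} i j with pos {r} {c} (inj₁ i) ℕ.<? pos {r} {c} (inj₂ j)
... | yes _ = inj₂ j
... | no  _ = inj₁ i

Noncrossing : ∀ {r c} → Subgraph r c → Set
Noncrossing {r} {c} H =
  ∀ (i i' : Fin r) (j j' : Fin c) → Edge H i j → Edge H i' j' →
  ¬ ( pos (tailV i j) ℕ.< pos (tailV i' j') ×
      pos (tailV i' j') ℕ.< pos (headV i j) ×
      pos (headV i j) ℕ.< pos (headV i' j') )

HasIncoming HasOutgoing : ∀ {r c} → Subgraph r c → Vertex r c → Set
HasIncoming H v = ∃ λ i → ∃ λ j → Edge H i j × headV i j ≡ v
HasOutgoing H v = ∃ λ i → ∃ λ j → Edge H i j × tailV i j ≡ v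

AlternatingVertex : ∀ {r c} → Subgraph r c → Vertex r c → Set
AlternatingVertex H v = ¬ (HasIncoming H v × HasOutgoing H v)

Alternating : ∀ {r c} → Subgraph r c → Set
Alternating {r} {c} H = ∀ (v : Vertex r c) → AlternatingVertex H v

-- A cycle in the bipartite graph H: x_{a0} y_{b0} x_{a1} y_{b1} … x_{an} y_{bn} x_{a0}
-- with n ≥ 1 (length 2(n+1) ≥ 4), all vertices distinct.
record Cycle {r c : ℕ} (H : Subgraph r c) : Set where
  field
    n      : ℕ
    n≥1    : 1 ℕ.≤ n
    xs     : Fin (suc n) → Fin r
    ys     : Fin (suc n) → Fin c
    xs-inj : Injective _≡_ _≡_ xs
    ys-inj : Injective _≡_ _≡_ ys
    edge-same : ∀ (t : Fin (suc n)) → Edge H (xs t) (ys t)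
    edge-next : ∀ (t : Fin n) → Edge H (xs (suc t)) (ys (inject₁ t))
    edge-close : Edge H (xs zero) (ys (fromℕ n))

IsSpanningForest : ∀ {r c} → Subgraph r c → SkewDiagram r c → Set
IsSpanningForest H D = IsSubgraphOf H D × ¬ Cycle H

data Conn {r c : ℕ} (E : Fin r → Fin c → Set) : Vertex r c → Vertex r c → Set where
  here   : ∀ {v} → Conn E v v
  stepxy : ∀ {i j w} → E i j → Conn E (inj₂ j) w → Conn E (inj₁ i) w
  stepyx : ∀ {i j w} → E i j → Conn E (inj₁ i) w → Conn E (inj₂ j) w

-- G_D has exactly k connected components: there are k pairwise
-- disconnected representatives, and every vertex is connected to one.
NumComponents : ∀ {r c} → SkewDiagram r c → ℕ → Set
NumComponents {r} {c} D k =
  Σ (Fin k → Vertex r c) λ rep →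
    (∀ a b → Conn (Box D) (rep a) (rep b) → a ≡ b) ×
    (∀ (v : Vertex r c) → ∃ λ a → Conn (Box D) v (rep a))

NCAForest : ∀ {r c} → SkewDiagram r c → ℕ → Subgraph r c → Set
NCAForest {r} {c} D k F =
  IsSpanningForest F D × Noncrossing F × Alternating F ×
  numEdges F ≡ (r ℕ.+ c) ℕ.∸ k

unitℚ : ∀ {n} → Fin n → Fin n → ℚ
unitℚ a b with a ≟ᶠ b
... | yes _ = 1ℚ
... | no  _ = 0ℚ

edgePoint : ∀ {r c} → Fin r → Fin c → Fin (r ℕ.+ c) → ℚ
edgePoint {r} {c} i j k = unitℚ (i ↑ˡ c) k ℚ.- unitℚ (r ↑ʳ j) k

affine : ∀ {n} → (Fin n → ℚ) → ℚ → (Fin n → ℚ) → ℚ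
affine {n} w t z = sumℚ n (λ k → w k ℚ.* z k) ℚ.+ t

-- Regularity of a triangulation of the convex hull of the points
-- pt v (v : Vert), with maximal cells σ : Cell having vertex sets cellVert σ:
-- there are heights h on the points such that the concave piecewise linear
-- function (upper envelope of the lifted points) is linear exactly on the
-- cells, i.e. for each cell some affine function agrees with h on the
-- vertices of the cell and lies strictly above h at all other points.
IsRegularTriangulation : (n : ℕ) (Vert : Set) (pt : Vert → Fin n → ℚ)
  (Cell : Set) (cellVert : Cell → Vert → Set) → Set
IsRegularTriangulation n Vert pt Cell cellVert =
  Σ (Vert → ℚ) λ h →
    ∀ (σ : Cell) → Σ (Fin n → ℚ) λ w → Σ ℚ λ t →
      ∀ (v : Vert) →
        (cellVert σ v → affine w t (pt v) ≡ h v) ×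
        (¬ cellVert σ v → h v ℚ.< affine w t (pt v))

EdgeOf : ∀ {r c} → SkewDiagram r c → Set
EdgeOf {r} {c} D = Σ (Fin r × Fin c) λ { (i , j) → Box D i j }

edgeOfPoint : ∀ {r c} (D : SkewDiagram r c) → EdgeOf D → Fin (r ℕ.+ c) → ℚ
edgeOfPoint D ((i , j) , _) = edgePoint i j

NCACell : ∀ {r c} → SkewDiagram r c → ℕ → Set
NCACell {r} {c} D k = Σ (Subgraph r c) (NCAForest D k)

ncaCellVert : ∀ {r c} (D : SkewDiagram r c) (k : ℕ) → NCACell D k → EdgeOf D → Set
ncaCellVert D k (F , _) ((i , j) , _) = Edge F i j

module Submission where

-- Give the point e_i - e_{r+j} of the box (i,j) the height -ij (rows and columns counted
-- from 0).  For a cell F it suffices to find row potentials U and column potentials V with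
-- U_i - V_j ≥ -ij on D, with equality exactly on the edges of F.
--
-- All x-vertices precede all y-vertices on the line, so two edges of F cross iff one lies
-- strictly northwest of the other.
-- Call a row attached if it shares a column with the row above it; the first row of each
-- component is not, so at most r - k rows are attached.  Call an edge of F a top edge if it
-- is the highest edge of F in its column, and a step edge otherwise.  Each column has at most
-- one top edge, and by noncrossing each row at most one step edge, none unless the row is
-- attached.  So |F| ≤ c + (r - k), and |F| = r + c - k forces a top edge in every column and
-- a step edge, in some column step(m), in every attached row m.
--
-- Put U_0 = 0, U_(m+1) = U_m - step(m+1) and G_b(m) = U_m + mb, so that
-- G_b(m+1) - G_b(m) = b - step(m+1).  By noncrossing, G_b decreases weakly down to the top
-- edge (t,b) of column b and increases weakly below it, and G_b(a) = G_b(t) exactly when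
-- (a,b) is an edge of F; so V_b = G_b(t) works.

open import Defs
open import Data.Nat using (ℕ; _+_)

import Data.Nat.Properties as ℕ
open import Algebra.Properties.CommutativeMonoid.Sum ℕ.+-0-commutativeMonoid
  using (sum; sum-cong-≗; ∑-distrib-+; ∑-comm)
open import Data.Bool using (Bool; true; false; if_then_else_)
import Data.Bool.Properties as Bool
open import Data.Empty using (⊥; ⊥-elim)
open import Data.Fin as Fin using (Fin; zero; suc; toℕ; fromℕ<; punchIn; punchOut; _↑ˡ_; _↑ʳ_)
open import Data.Fin.Properties
  using (toℕ<n; toℕ-fromℕ<; fromℕ<-toℕ; toℕ-injective; 0≢1+n; suc-injective; any?;
         punchIn-injective; punchInᵢ≢i; punchOut-injective; punchIn-punchOut)
open import Data.Integer as ℤ using (ℤ; +_; 0ℤ)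
import Data.Integer.Properties as ℤ
import Data.Integer.Solver as ℤ
open import Data.Nat using (zero; suc; _*_; _∸_; _≤_; _<_; z≤n; s≤s; _<?_)
open import Data.Nat.Properties
  using (≤-refl; ≤-reflexive; ≤-trans; ≤-antisym; <⇒≤; <-trans; ≤-<-trans; <-≤-trans; <⇒≱; ≮⇒≥;
         ≤∧≢⇒<; <-cmp; n≮0; n<1+n; n≤1+n; m≤n⇒m≤1+n; m≤n⇒m<n∨m≡n; m≤m+n; m≤n+m; m≤n+m∸n;
         +-comm; +-identityʳ; +-mono-≤; +-monoˡ-≤; +-monoʳ-<; +-mono-<-≤; +-mono-≤-<; ∸-monoʳ-<;
         anyUpTo?; module ≤-Reasoning)
import Data.Nat.Solver as ℕ
open import Data.Product using (Σ; ∃; ∃₂; _×_; _,_; proj₁; proj₂)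
open import Data.Rational as ℚ using (ℚ; 0ℚ; 1ℚ)
import Data.Rational.Properties as ℚ
open import Data.Rational.Literals using (fromℤ)
import Data.Rational.Solver as ℚ
import Data.Rational.Unnormalised as ℚᵘ
import Data.Rational.Unnormalised.Properties as ℚᵘ
open import Data.Sum using (inj₁; inj₂)
open import Data.Vec.Functional using (_++_)
open import Data.Vec.Functional.Properties using (lookup-++ˡ; lookup-++ʳ)
open import Function using (_∘_; flip)
open import Function.Definitions using (Injective)
open import Relation.Binary.Core using (Rel)
open import Relation.Binary.Definitions using (Reflexive; Transitive; tri<; tri≈; tri>)
import Relation.Binary.Definitions as Binary
open import Relation.Binary.PropositionalEquality
  using (_≡_; _≢_; refl; sym; trans; cong; cong₂; subst; subst₂; module ≡-Reasoning)
open import Relation.Nullary using (¬_; Dec; yes; no; does; _×-dec_; ¬?)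
open import Relation.Unary using (Pred; Decidable)

extend : ∀ {A : Set} {n} → A → (Fin n → A) → ℕ → A
extend {n = zero}  d f m       = d
extend {n = suc n} d f zero    = f zero
extend {n = suc n} d f (suc m) = extend d (f ∘ suc) m

extend-toℕ : ∀ {A : Set} {n} (d : A) (f : Fin n → A) (i : Fin n) → extend d f (toℕ i) ≡ f i
extend-toℕ d f zero    = refl
extend-toℕ d f (suc i) = extend-toℕ d (f ∘ suc) i

extend-< : ∀ {A : Set} {n m} (d : A) (f : Fin n → A) (m<n : m < n) → extend d f m ≡ f (fromℕ< m<n)
extend-< {m = zero}  d f (s≤s _)   = refl
extend-< {m = suc m} d f (s≤s m<n) = extend-< d (f ∘ suc) m<n

extend-≥ : ∀ {A : Set} {n m} (d : A) (f : Fin n → A) → n ≤ m → extend d f m ≡ d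
extend-≥ {n = zero}  d f _         = refl
extend-≥ {n = suc n} d f (s≤s n≤m) = extend-≥ d (f ∘ suc) n≤m

extend-all : ∀ {A : Set} {n} (P : A → Set) {d : A} {f : Fin n → A} →
             P d → (∀ i → P (f i)) → ∀ m → P (extend d f m)
extend-all {n = zero}  P Pd Pf m       = Pd
extend-all {n = suc n} P Pd Pf zero    = Pf zero
extend-all {n = suc n} P Pd Pf (suc m) = extend-all P Pd (Pf ∘ suc) m

extend-nondefault : ∀ {A : Set} {n m} {d x : A} (f : Fin n → A) →
                    extend d f m ≡ x → x ≢ d → ∃ λ i → toℕ i ≡ m × f i ≡ x
extend-nondefault {n = zero}          f d≡x x≢d = ⊥-elim (x≢d (sym d≡x))
extend-nondefault {n = suc n} {zero}  f f₀≡x _   = zero , refl , f₀≡x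
extend-nondefault {n = suc n} {suc m} f e   x≢d =
  let i , toℕi≡m , fi≡x = extend-nondefault (f ∘ suc) e x≢d in suc i , cong suc toℕi≡m , fi≡x

extend-antitone : ∀ {n} (f : Fin n → ℕ) → (∀ i j → toℕ i ≤ toℕ j → f j ≤ f i) →
                  ∀ {m m′} → m ≤ m′ → extend 0 f m′ ≤ extend 0 f m
extend-antitone {n} f f-anti {m} {m′} m≤m′ with m′ <? n
... | no  m′≮n = subst (_≤ extend 0 f m) (sym (extend-≥ 0 f (≮⇒≥ m′≮n))) z≤n
... | yes m′<n rewrite extend-< 0 f m′<n | extend-< 0 f (≤-<-trans m≤m′ m′<n) =
  f-anti _ _ (subst₂ _≤_ (sym (toℕ-fromℕ< _)) (sym (toℕ-fromℕ< m′<n)) m≤m′)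

choose : ∀ {n} {P : ℕ → ℕ → Set} → (∀ (i : Fin n) → ∃ (P (toℕ i))) → ℕ → ℕ
choose h = extend 0 (proj₁ ∘ h)

choose-spec : ∀ {n m} {P : ℕ → ℕ → Set} (h : ∀ (i : Fin n) → ∃ (P (toℕ i))) →
              m < n → P m (choose {P = P} h m)
choose-spec {P = P} h m<n rewrite extend-< 0 (proj₁ ∘ h) m<n =
  subst (λ x → P x (proj₁ (h (fromℕ< m<n)))) (toℕ-fromℕ< m<n) (proj₂ (h (fromℕ< m<n)))

dec-choice : ∀ {a p} {A : Set a} {P : ℕ → Set p} → Dec A → (A → ∃ P) → ∃ λ n → A → P n
dec-choice (yes a) h = proj₁ (h a) , λ _ → proj₂ (h a)
dec-choice (no ¬a) h = 0 , λ a → ⊥-elim (¬a a)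

chain : ∀ {a ℓ} {A : Set a} (R : Rel A ℓ) → Reflexive R → Transitive R →
        (f : ℕ → A) {s t : ℕ} → s ≤ t →
        (∀ {m} → s ≤ m → m < t → R (f m) (f (suc m))) → R (f s) (f t)
chain R R-refl R-trans f {t = zero}  z≤n _ = R-refl
chain R R-refl R-trans f {t = suc t} s≤1+t step with m≤n⇒m<n∨m≡n s≤1+t
... | inj₂ refl      = R-refl
... | inj₁ (s≤s s≤t) =
  R-trans (chain R R-refl R-trans f s≤t (λ s≤m m<t → step s≤m (m≤n⇒m≤1+n m<t))) (step s≤t ≤-refl)

indicator : Bool → ℕ
indicator true  = 1
indicator false = 0

if-indicator : ∀ b → (if b then 1 else 0) ≡ indicator (does (b Bool.≟ true))
if-indicator true  = refl
if-indicator false = refl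

indicator-split : ∀ {a b} {A : Set a} {B : Set b} (A? : Dec A) (B? : Dec B) →
  indicator (does A?) ≡ indicator (does (A? ×-dec ¬? B?)) + indicator (does (A? ×-dec B?))
indicator-split (yes _) (yes _) = refl
indicator-split (yes _) (no _)  = refl
indicator-split (no _)  _       = refl

sumℕ≡sum : ∀ n (f : Fin n → ℕ) → sumℕ n f ≡ sum f
sumℕ≡sum zero    f = refl
sumℕ≡sum (suc n) f = cong (λ s → f zero + s) (sumℕ≡sum n (f ∘ suc))

∑-const-1 : ∀ n → sum {n} (λ _ → 1) ≡ n
∑-const-1 zero    = refl
∑-const-1 (suc n) = cong suc (∑-const-1 n)

∑-mono-≤ : ∀ {n} {f g : Fin n → ℕ} → (∀ i → f i ≤ g i) → sum f ≤ sum g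
∑-mono-≤ {zero}  f≤g = z≤n
∑-mono-≤ {suc n} f≤g = +-mono-≤ (f≤g zero) (∑-mono-≤ (f≤g ∘ suc))

∑-tight : ∀ {n} {f g : Fin n → ℕ} → (∀ i → f i ≤ g i) → sum g ≤ sum f → ∀ i → g i ≤ f i
∑-tight {suc n} f≤g ∑g≤∑f zero =
  ≮⇒≥ λ f₀<g₀ → <⇒≱ (+-mono-<-≤ f₀<g₀ (∑-mono-≤ (f≤g ∘ suc))) ∑g≤∑f
∑-tight {suc n} {f} {g} f≤g ∑g≤∑f (suc i) = ∑-tight (f≤g ∘ suc) ∑tail i
  where
  ∑tail : sum (g ∘ suc) ≤ sum (f ∘ suc)
  ∑tail = ≮⇒≥ λ ∑f<∑g → <⇒≱ (+-mono-≤-< (f≤g zero) ∑f<∑g) ∑g≤∑f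

+-tight : ∀ {x y a b} → x ≤ a → y ≤ b → a + b ≤ x + y → a ≤ x × b ≤ y
+-tight x≤a y≤b a+b≤x+y =
  ≮⇒≥ (λ x<a → <⇒≱ (+-mono-<-≤ x<a y≤b) a+b≤x+y) ,
  ≮⇒≥ (λ y<b → <⇒≱ (+-mono-≤-< x≤a y<b) a+b≤x+y)

count : ∀ {n p} {P : Pred (Fin n) p} → Decidable P → ℕ
count P? = sum (λ i → indicator (does (P? i)))

count≡0 : ∀ {n p} {P : Pred (Fin n) p} (P? : Decidable P) → (∀ i → ¬ P i) → count P? ≡ 0
count≡0 {zero}  P? ¬P = refl
count≡0 {suc n} P? ¬P with P? zero
... | yes P₀ = ⊥-elim (¬P zero P₀)
... | no  _  = count≡0 (P? ∘ suc) (¬P ∘ suc)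

count≤1 : ∀ {n p} {P : Pred (Fin n) p} (P? : Decidable P) →
          (∀ {i j} → P i → P j → i ≡ j) → count P? ≤ 1
count≤1 {zero}  P? unique = z≤n
count≤1 {suc n} P? unique with P? zero
... | yes P₀ = ≤-reflexive (cong suc (count≡0 (P? ∘ suc) (λ i P₁₊ᵢ → 0≢1+n (unique P₀ P₁₊ᵢ))))
... | no  _  = count≤1 (P? ∘ suc) (λ Pᵢ Pⱼ → suc-injective (unique Pᵢ Pⱼ))

count>0⇒∃ : ∀ {n p} {P : Pred (Fin n) p} (P? : Decidable P) → 1 ≤ count P? → ∃ P
count>0⇒∃ {suc n} P? 1≤count with P? zero
... | yes P₀ = zero , P₀
... | no  _  = let i , P₁₊ᵢ = count>0⇒∃ (P? ∘ suc) 1≤count in suc i , P₁₊ᵢ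

punchOut-zero : ∀ {k n} (f : Fin k → Fin (suc n)) → Injective _≡_ _≡_ f → (∀ a → f a ≢ zero) →
                ∃ λ (g : Fin k → Fin n) → Injective _≡_ _≡_ g × (∀ a → suc (g a) ≡ f a)
punchOut-zero f f-inj f≢0 =
  (λ a → punchOut (f≢0 a ∘ sym)) ,
  (λ {a} {b} ga≡gb → f-inj (punchOut-injective (f≢0 a ∘ sym) (f≢0 b ∘ sym) ga≡gb)) ,
  (λ a → punchIn-punchOut (f≢0 a ∘ sym))

injective⇒≤count : ∀ {k n p} {P : Pred (Fin n) p} (P? : Decidable P) (f : Fin k → Fin n) →
                   Injective _≡_ _≡_ f → (∀ a → P (f a)) → k ≤ count P?
injective⇒≤count {zero}  P? f _ _ = z≤n
injective⇒≤count {suc k} {zero} P? f _ _ with f zero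
... | ()
injective⇒≤count {suc k} {suc n} {P = P} P? f f-inj Pf with any? (λ a → f a Fin.≟ zero)
... | no f≢0 =
  let g , g-inj , suc∘g≡f = punchOut-zero f f-inj (λ a fa≡0 → f≢0 (a , fa≡0))
  in  ≤-trans (injective⇒≤count (P? ∘ suc) g g-inj (λ a → subst P (sym (suc∘g≡f a)) (Pf a)))
              (m≤n+m _ _)
... | yes (a , fa≡0) with P? zero
...   | no ¬P₀ = ⊥-elim (¬P₀ (subst P fa≡0 (Pf a)))
...   | yes _  =
  let f∘punchIn≢0 b fb≡0 = punchInᵢ≢i a b (f-inj (trans fb≡0 (sym fa≡0)))
      g , g-inj , suc∘g≡f = punchOut-zero (f ∘ punchIn a) (punchIn-injective a _ _ ∘ f-inj) f∘punchIn≢0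
  in  s≤s (injective⇒≤count (P? ∘ suc) g g-inj (λ b → subst P (sym (suc∘g≡f b)) (Pf (punchIn a b))))

[i+k]-k≡i : ∀ i k → i ℤ.+ k ℤ.- k ≡ i
[i+k]-k≡i i k = trans (ℤ.+-assoc i k (ℤ.- k)) (trans (cong (λ z → i ℤ.+ z) (ℤ.+-inverseʳ k)) (ℤ.+-identityʳ i))

+-cancelʳ-≤ : ∀ {i j} k → i ℤ.+ k ℤ.≤ j ℤ.+ k → i ℤ.≤ j
+-cancelʳ-≤ {i} {j} k i+k≤j+k =
  subst₂ ℤ._≤_ ([i+k]-k≡i i k) ([i+k]-k≡i j k) (ℤ.+-monoˡ-≤ (ℤ.- k) i+k≤j+k)

+-cancelʳ-< : ∀ {i j} k → i ℤ.+ k ℤ.< j ℤ.+ k → i ℤ.< j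
+-cancelʳ-< {i} {j} k i+k<j+k =
  subst₂ ℤ._<_ ([i+k]-k≡i i k) ([i+k]-k≡i j k) (ℤ.+-monoˡ-< (ℤ.- k) i+k<j+k)

balance-≤ : ∀ {i j m n} → i ℤ.+ + m ≡ j ℤ.+ + n → m ≤ n → j ℤ.≤ i
balance-≤ {i} {j} {m} eq m≤n =
  +-cancelʳ-≤ (+ m) (ℤ.≤-trans (ℤ.+-monoʳ-≤ j (ℤ.+≤+ m≤n)) (ℤ.≤-reflexive (sym eq)))

balance-< : ∀ {i j m n} → i ℤ.+ + m ≡ j ℤ.+ + n → m < n → j ℤ.< i
balance-< {i} {j} {m} eq m<n =
  +-cancelʳ-< (+ m) (ℤ.<-≤-trans (ℤ.+-monoʳ-< j (ℤ.+<+ m<n)) (ℤ.≤-reflexive (sym eq)))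

fromℤ-homo-+ : ∀ i j → fromℤ (i ℤ.+ j) ≡ fromℤ i ℚ.+ fromℤ j
fromℤ-homo-+ i j =
  ℚ.toℚᵘ-injective (ℚᵘ.≃-trans (ℚᵘ.*≡* i+j≡) (ℚᵘ.≃-sym (ℚ.toℚᵘ-homo-+ (fromℤ i) (fromℤ j))))
  where
  i+j≡ : (i ℤ.+ j) ℤ.* + 1 ≡ (i ℤ.* + 1 ℤ.+ j ℤ.* + 1) ℤ.* + 1
  i+j≡ rewrite ℤ.*-identityʳ i | ℤ.*-identityʳ j | ℤ.*-identityʳ (i ℤ.+ j) = refl

fromℤ-homo‿- : ∀ i → fromℤ (ℤ.- i) ≡ ℚ.- fromℤ i
fromℤ-homo‿- (+ zero)   = refl
fromℤ-homo‿- (+ suc n)  = refl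
fromℤ-homo‿- ℤ.-[1+ n ] = refl

fromℤ-homo-minus : ∀ i j → fromℤ (i ℤ.- j) ≡ fromℤ i ℚ.- fromℤ j
fromℤ-homo-minus i j = trans (fromℤ-homo-+ i (ℤ.- j)) (cong (λ q → fromℤ i ℚ.+ q) (fromℤ-homo‿- j))

fromℤ-mono-< : ∀ {i j} → i ℤ.< j → fromℤ i ℚ.< fromℤ j
fromℤ-mono-< {i} {j} i<j = ℚ.*<* (subst₂ ℤ._<_ (sym (ℤ.*-identityʳ i)) (sym (ℤ.*-identityʳ j)) i<j)

sumℚ-cong : ∀ n {f g : Fin n → ℚ} → (∀ k → f k ≡ g k) → sumℚ n f ≡ sumℚ n g
sumℚ-cong zero    f≗g = refl
sumℚ-cong (suc n) f≗g = cong₂ ℚ._+_ (f≗g zero) (sumℚ-cong n (f≗g ∘ suc))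

sumℚ-zero : ∀ n {f : Fin n → ℚ} → (∀ k → f k ≡ 0ℚ) → sumℚ n f ≡ 0ℚ
sumℚ-zero zero    f≗0 = refl
sumℚ-zero (suc n) f≗0 = trans (cong₂ ℚ._+_ (f≗0 zero) (sumℚ-zero n (f≗0 ∘ suc))) (ℚ.+-identityˡ 0ℚ)

sumℚ-*-distrib-minus : ∀ n (w x y : Fin n → ℚ) →
  sumℚ n (λ k → w k ℚ.* (x k ℚ.- y k)) ≡ sumℚ n (λ k → w k ℚ.* x k) ℚ.- sumℚ n (λ k → w k ℚ.* y k)
sumℚ-*-distrib-minus zero    w x y = refl
sumℚ-*-distrib-minus (suc n) w x y rewrite sumℚ-*-distrib-minus n (w ∘ suc) (x ∘ suc) (y ∘ suc) =
  solve 5 (λ w x y ∑wx ∑wy → w :* (x :- y) :+ (∑wx :- ∑wy) := (w :* x :+ ∑wx) :- (w :* y :+ ∑wy)) refl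
    (w zero) (x zero) (y zero) (sumℚ n (λ k → w (suc k) ℚ.* x (suc k))) (sumℚ n (λ k → w (suc k) ℚ.* y (suc k)))
  where open ℚ.+-*-Solver

unitℚ-suc : ∀ {n} (a k : Fin n) → unitℚ (suc a) (suc k) ≡ unitℚ a k
unitℚ-suc a k with a Fin.≟ k
... | yes _ = refl
... | no  _ = refl

sumℚ-unit : ∀ n (w : Fin n → ℚ) (a : Fin n) → sumℚ n (λ k → w k ℚ.* unitℚ a k) ≡ w a
sumℚ-unit (suc n) w zero = begin
  w zero ℚ.* 1ℚ ℚ.+ sumℚ n (λ k → w (suc k) ℚ.* 0ℚ)
    ≡⟨ cong₂ ℚ._+_ (ℚ.*-identityʳ (w zero)) (sumℚ-zero n (ℚ.*-zeroʳ ∘ w ∘ suc)) ⟩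
  w zero ℚ.+ 0ℚ
    ≡⟨ ℚ.+-identityʳ (w zero) ⟩
  w zero ∎
  where open ≡-Reasoning
sumℚ-unit (suc n) w (suc a) = begin
  w zero ℚ.* 0ℚ ℚ.+ sumℚ n (λ k → w (suc k) ℚ.* unitℚ (suc a) (suc k))
    ≡⟨ cong₂ ℚ._+_ (ℚ.*-zeroʳ (w zero))
                   (sumℚ-cong n (λ k → cong (λ u → w (suc k) ℚ.* u) (unitℚ-suc a k))) ⟩
  0ℚ ℚ.+ sumℚ n (λ k → w (suc k) ℚ.* unitℚ a k)
    ≡⟨ ℚ.+-identityˡ _ ⟩
  sumℚ n (λ k → w (suc k) ℚ.* unitℚ a k)
    ≡⟨ sumℚ-unit n (w ∘ suc) a ⟩
  w (suc a) ∎
  where open ≡-Reasoning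

affine-edgePoint : ∀ {r c} (w : Fin (r + c) → ℚ) (t : ℚ) (i : Fin r) (j : Fin c) →
                   affine w t (edgePoint i j) ≡ w (i ↑ˡ c) ℚ.- w (r ↑ʳ j) ℚ.+ t
affine-edgePoint {r} {c} w t i j =
  cong (ℚ._+ t) (trans (sumℚ-*-distrib-minus (r + c) w (unitℚ (i ↑ˡ c)) (unitℚ (r ↑ʳ j)))
                       (cong₂ ℚ._-_ (sumℚ-unit (r + c) w (i ↑ˡ c)) (sumℚ-unit (r + c) w (r ↑ʳ j))))

affine-potential : ∀ {r c} (U : Fin r → ℤ) (V : Fin c → ℤ) (i : Fin r) (j : Fin c) →
                   affine ((fromℤ ∘ U) ++ (fromℤ ∘ V)) 0ℚ (edgePoint i j) ≡ fromℤ (U i ℤ.- V j)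
affine-potential {r} {c} U V i j = begin
  affine w 0ℚ (edgePoint i j)       ≡⟨ affine-edgePoint w 0ℚ i j ⟩
  w (i ↑ˡ c) ℚ.- w (r ↑ʳ j) ℚ.+ 0ℚ  ≡⟨ ℚ.+-identityʳ _ ⟩
  w (i ↑ˡ c) ℚ.- w (r ↑ʳ j)         ≡⟨ cong₂ ℚ._-_ (lookup-++ˡ (fromℤ ∘ U) (fromℤ ∘ V) i)
                                                   (lookup-++ʳ (fromℤ ∘ U) (fromℤ ∘ V) j) ⟩
  fromℤ (U i) ℚ.- fromℤ (V j)       ≡⟨ sym (fromℤ-homo-minus (U i) (V j)) ⟩
  fromℤ (U i ℤ.- V j)               ∎
  where
  open ≡-Reasoning
  w : Fin (r + c) → ℚ
  w = (fromℤ ∘ U) ++ (fromℤ ∘ V)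

x-before-y : ∀ {r c} (i : Fin r) (j : Fin c) → pos {r} {c} (inj₁ i) < pos {r} {c} (inj₂ j)
x-before-y {r} i j = <-≤-trans (∸-monoʳ-< {o = 0} (s≤s z≤n) (toℕ<n i)) (m≤m+n r _)

tailV≡x : ∀ {r c} (i : Fin r) (j : Fin c) → tailV i j ≡ inj₁ i
tailV≡x {r} {c} i j with pos {r} {c} (inj₁ i) <? pos {r} {c} (inj₂ j)
... | yes _   = refl
... | no  x≮y = ⊥-elim (x≮y (x-before-y i j))

headV≡y : ∀ {r c} (i : Fin r) (j : Fin c) → headV i j ≡ inj₂ j
headV≡y {r} {c} i j with pos {r} {c} (inj₁ i) <? pos {r} {c} (inj₂ j)
... | yes _   = refl
... | no  x≮y = ⊥-elim (x≮y (x-before-y i j))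

noncrossing⇒no-northwest : ∀ {r c} {F : Subgraph r c} → Noncrossing F →
  ∀ {i i′ j j′} → Edge F i j → Edge F i′ j′ → toℕ i′ < toℕ i → toℕ j′ < toℕ j → ⊥
noncrossing⇒no-northwest {r} {c} noncrossing {i} {i′} {j} {j′} Fij Fi′j′ i′<i j′<j =
  noncrossing i i′ j j′ Fij Fi′j′ crossing
  where
  crossing : pos (tailV i j) < pos (tailV i′ j′) × pos (tailV i′ j′) < pos (headV i j) ×
             pos (headV i j) < pos (headV i′ j′)
  crossing rewrite tailV≡x i j | tailV≡x i′ j′ | headV≡y i j | headV≡y i′ j′ =
    ∸-monoʳ-< (s≤s i′<i) (toℕ<n i) , x-before-y i′ j , +-monoʳ-< r (∸-monoʳ-< (s≤s j′<j) (toℕ<n j))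

Conn-trans : ∀ {r c} {E : Fin r → Fin c → Set} {u v w} → Conn E u v → Conn E v w → Conn E u w
Conn-trans here         v~w = v~w
Conn-trans (stepxy e p) v~w = stepxy e (Conn-trans p v~w)
Conn-trans (stepyx e p) v~w = stepyx e (Conn-trans p v~w)

Conn-sym : ∀ {r c} {E : Fin r → Fin c → Set} {u v} → Conn E u v → Conn E v u
Conn-sym here         = here
Conn-sym (stepxy e p) = Conn-trans (Conn-sym p) (stepyx e here)
Conn-sym (stepyx e p) = Conn-trans (Conn-sym p) (stepxy e here)

NorthwestFree : (ℕ → ℕ → Set) → Set
NorthwestFree E = ∀ {m n m′ n′} → E m n → E m′ n′ → m′ < m → n′ < n → ⊥

module SkewShape (lam mu : ℕ → ℕ)
  (lam-anti : ∀ {m m′} → m ≤ m′ → lam m′ ≤ lam m)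
  (mu-anti  : ∀ {m m′} → m ≤ m′ → mu m′ ≤ mu m) where

  Boxℕ : ℕ → ℕ → Set
  Boxℕ m n = mu m ≤ n × n < lam m

  Attached : ℕ → Set
  Attached zero    = ⊥
  Attached (suc m) = mu m < lam (suc m)

  attached? : Decidable Attached
  attached? zero    = no λ ()
  attached? (suc m) = mu m <? lam (suc m)

  attached⇒Boxℕ : ∀ {m} → Attached (suc m) → Boxℕ (suc m) (mu m)
  attached⇒Boxℕ {m} att = mu-anti (n≤1+n m) , att

  between-boxes⇒attached : ∀ {x y m n} → Boxℕ x n → Boxℕ y n → x < m → m ≤ y → Attached m
  between-boxes⇒attached {m = suc m} (mu[x]≤n , _) (_ , n<lam[y]) (s≤s x≤m) 1+m≤y =
    ≤-<-trans (≤-trans (mu-anti x≤m) mu[x]≤n) (<-≤-trans n<lam[y] (lam-anti 1+m≤y))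

  headRow : ℕ → ℕ
  headRow zero    = zero
  headRow (suc m) with attached? (suc m)
  ... | yes _ = headRow m
  ... | no  _ = suc m

  headRow-≤ : ∀ m → headRow m ≤ m
  headRow-≤ zero    = z≤n
  headRow-≤ (suc m) with attached? (suc m)
  ... | yes _ = m≤n⇒m≤1+n (headRow-≤ m)
  ... | no  _ = ≤-refl

  headRow-unattached : ∀ m → ¬ Attached (headRow m)
  headRow-unattached zero    = λ ()
  headRow-unattached (suc m) with attached? (suc m)
  ... | yes _          = headRow-unattached m
  ... | no  unattached = unattached

  module Edges {E : ℕ → ℕ → Set} (E? : Binary.Decidable E)
    (E⇒Boxℕ : ∀ {m n} → E m n → Boxℕ m n) (northwestFree : NorthwestFree E) where

    EdgeAbove TopEdge StepEdge : ℕ → ℕ → Set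
    EdgeAbove m n = ∃ λ p → p < m × E p n
    TopEdge   m n = E m n × ¬ EdgeAbove m n
    StepEdge  m n = E m n × EdgeAbove m n

    edgeAbove? : Binary.Decidable EdgeAbove
    edgeAbove? m n = anyUpTo? (λ p → E? p n) m

    topEdge? : Binary.Decidable TopEdge
    topEdge? m n = E? m n ×-dec ¬? (edgeAbove? m n)

    stepEdge? : Binary.Decidable StepEdge
    stepEdge? m n = E? m n ×-dec edgeAbove? m n

    topEdge-unique : ∀ {m m′ n} → TopEdge m n → TopEdge m′ n → m ≡ m′
    topEdge-unique {m} {m′} (Emn , ¬above) (Em′n , ¬above′) with <-cmp m m′
    ... | tri< m<m′ _ _ = ⊥-elim (¬above′ (m , m<m′ , Emn))
    ... | tri≈ _ m≡m′ _ = m≡m′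
    ... | tri> _ _ m′<m = ⊥-elim (¬above (m′ , m′<m , Em′n))

    stepEdge-unique : ∀ {m n n′} → StepEdge m n → StepEdge m n′ → n ≡ n′
    stepEdge-unique {n = n} {n′} (Emn , p , p<m , Epn) (Emn′ , p′ , p′<m , Ep′n′) with <-cmp n n′
    ... | tri< n<n′ _ _ = ⊥-elim (northwestFree Emn′ Epn p<m n<n′)
    ... | tri≈ _ n≡n′ _ = n≡n′
    ... | tri> _ _ n′<n = ⊥-elim (northwestFree Emn Ep′n′ p′<m n′<n)

    stepEdge⇒attached : ∀ {m n} → StepEdge m n → Attached m
    stepEdge⇒attached (Emn , p , p<m , Epn) =
      between-boxes⇒attached (E⇒Boxℕ Epn) (E⇒Boxℕ Emn) p<m ≤-refl

    module Potential (step : ℕ → ℕ) (step-edge : ∀ {m} → Attached m → StepEdge m (step m)) where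

      U : ℕ → ℤ
      U zero    = 0ℤ
      U (suc m) = U m ℤ.- + step (suc m)

      G : ℕ → ℕ → ℤ
      G b m = U m ℤ.+ + (m * b)

      G-suc : ∀ b m → G b (suc m) ℤ.+ + step (suc m) ≡ G b m ℤ.+ + b
      G-suc b m rewrite ℤ.pos-+ b (m * b) =
        solve 4 (λ u s b mb → u :- s :+ (b :+ mb) :+ s := u :+ mb :+ b) refl
          (U m) (+ step (suc m)) (+ b) (+ (m * b))
        where open ℤ.+-*-Solver

      G-≤-suc : ∀ {b m} → step (suc m) ≤ b → G b m ℤ.≤ G b (suc m)
      G-≤-suc {b} {m} = balance-≤ (G-suc b m)

      G-<-suc : ∀ {b m} → step (suc m) < b → G b m ℤ.< G b (suc m)
      G-<-suc {b} {m} = balance-< (G-suc b m)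

      G-suc-≤ : ∀ {b m} → b ≤ step (suc m) → G b (suc m) ℤ.≤ G b m
      G-suc-≤ {b} {m} = balance-≤ (sym (G-suc b m))

      G-suc-< : ∀ {b m} → b < step (suc m) → G b (suc m) ℤ.< G b m
      G-suc-< {b} {m} = balance-< (sym (G-suc b m))

      G-suc-≡ : ∀ {b m} → step (suc m) ≡ b → G b m ≡ G b (suc m)
      G-suc-≡ step≡b = ℤ.≤-antisym (G-≤-suc (≤-reflexive step≡b)) (G-suc-≤ (≤-reflexive (sym step≡b)))

      module _ {a b t} (box : Boxℕ a b) (t-top : TopEdge t b) where

        attached-below-top : ∀ {m} → t < m → m ≤ a → Attached m
        attached-below-top = between-boxes⇒attached (E⇒Boxℕ (proj₁ t-top)) box

        attached-above-top : ∀ {m} → a < m → m ≤ t → Attached m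
        attached-above-top = between-boxes⇒attached box (E⇒Boxℕ (proj₁ t-top))

        step-below-top-≤ : ∀ {m} → t < m → m ≤ a → step m ≤ b
        step-below-top-≤ t<m m≤a = ≮⇒≥ λ b<step →
          northwestFree (proj₁ (step-edge (attached-below-top t<m m≤a))) (proj₁ t-top) t<m b<step

        step-below-top-≡ : E a b → ∀ {m} → t < m → m ≤ a → step m ≡ b
        step-below-top-≡ Eab t<m m≤a with step-edge (attached-below-top t<m m≤a)
        ... | _ , p , p<m , Ep = ≤-antisym (step-below-top-≤ t<m m≤a)
                                   (≮⇒≥ λ step<b → northwestFree Eab Ep (<-≤-trans p<m m≤a) step<b)

        step-above-top-≥ : ∀ {m} → a < m → m ≤ t → b ≤ step m
        step-above-top-≥ a<m m≤t with step-edge (attached-above-top a<m m≤t)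
        ... | _ , p , p<m , Ep = ≮⇒≥ λ step<b → northwestFree (proj₁ t-top) Ep (<-≤-trans p<m m≤t) step<b

      G-top≡G-edge : ∀ {a b t} → E a b → TopEdge t b → G b t ≡ G b a
      G-top≡G-edge {a} {b} {t} Eab t-top with <-cmp t a
      ... | tri< t<a _ _ = chain _≡_ refl trans (G b) (<⇒≤ t<a) λ t≤m m<a →
              G-suc-≡ (step-below-top-≡ (E⇒Boxℕ Eab) t-top Eab (s≤s t≤m) m<a)
      ... | tri≈ _ t≡a _ = cong (G b) t≡a
      ... | tri> _ _ a<t = ⊥-elim (proj₂ t-top (a , a<t , Eab))

      G-top<G-nonedge : ∀ {a b t} → Boxℕ a b → ¬ E a b → TopEdge t b → G b t ℤ.< G b a
      G-top<G-nonedge {a} {b} {t} box ¬Eab t-top with <-cmp t a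
      ... | tri≈ _ refl _ = ⊥-elim (¬Eab (proj₁ t-top))
      G-top<G-nonedge {suc a} {b} {t} box ¬Eab t-top | tri< (s≤s t≤a) _ _ =
        ℤ.≤-<-trans
          (chain ℤ._≤_ ℤ.≤-refl ℤ.≤-trans (G b) t≤a λ t≤m m<a →
             G-≤-suc (step-below-top-≤ box t-top (s≤s t≤m) (m≤n⇒m≤1+n m<a)))
          (G-<-suc (≤∧≢⇒< (step-below-top-≤ box t-top (s≤s t≤a) ≤-refl) step≢b))
        where
        step≢b : step (suc a) ≢ b
        step≢b step≡b = ¬Eab (subst (E (suc a)) step≡b
          (proj₁ (step-edge (attached-below-top box t-top (s≤s t≤a) ≤-refl))))
      G-top<G-nonedge {a} {b} {suc t} box ¬Eab t-top | tri> _ _ (s≤s a≤t) =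
        ℤ.<-≤-trans
          (G-suc-< (≤∧≢⇒< (step-above-top-≥ box t-top (s≤s a≤t) ≤-refl) b≢step))
          (chain (flip ℤ._≤_) ℤ.≤-refl (flip ℤ.≤-trans) (G b) a≤t λ a≤m m<t →
             G-suc-≤ (step-above-top-≥ box t-top (s≤s a≤m) (m≤n⇒m≤1+n m<t)))
        where
        b≢step : b ≢ step (suc t)
        b≢step b≡step with step-edge (attached-above-top box t-top (s≤s a≤t) ≤-refl)
        ... | _ , p , p<t , Ep = proj₂ t-top (p , p<t , subst (E p) (sym b≡step) Ep)

      U-G : ∀ a b → U a ℤ.- G b a ≡ ℤ.- + (a * b)
      U-G a b = solve 2 (λ u ab → u :- (u :+ ab) := :- ab) refl (U a) (+ (a * b))
        where open ℤ.+-*-Solver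

      slack-on-edge : ∀ {a b t} → E a b → TopEdge t b → U a ℤ.- G b t ≡ ℤ.- + (a * b)
      slack-on-edge {a} {b} Eab t-top =
        trans (cong (λ g → U a ℤ.- g) (G-top≡G-edge Eab t-top)) (U-G a b)

      slack-off-edge : ∀ {a b t} → Boxℕ a b → ¬ E a b → TopEdge t b →
                       ℤ.- + (a * b) ℤ.< U a ℤ.- G b t
      slack-off-edge {a} {b} {t} box ¬Eab t-top =
        subst (ℤ._< U a ℤ.- G b t) (U-G a b)
              (ℤ.+-monoʳ-< (U a) (ℤ.neg-mono-< (G-top<G-nonedge box ¬Eab t-top)))

module Diagram {r c} (D : SkewDiagram r c) where
  open SkewDiagram D

  -- Rows past r are empty, so Boxℕ m n forces m < r and n < c.
  lamℕ muℕ : ℕ → ℕ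
  lamℕ = extend 0 lam
  muℕ  = extend 0 mu

  open SkewShape lamℕ muℕ (extend-antitone lam lam-decr) (extend-antitone mu mu-decr) public

  Box⇒Boxℕ : ∀ {i j} → Box D i j → Boxℕ (toℕ i) (toℕ j)
  Box⇒Boxℕ {i} box rewrite extend-toℕ 0 mu i | extend-toℕ 0 lam i = box

  Boxℕ⇒Box : ∀ {i j} → Boxℕ (toℕ i) (toℕ j) → Box D i j
  Boxℕ⇒Box {i} box rewrite extend-toℕ 0 mu i | extend-toℕ 0 lam i = box

  Boxℕ⇒row< : ∀ {m n} → Boxℕ m n → m < r
  Boxℕ⇒row< {m} {n} (_ , n<lam) with m <? r
  ... | yes m<r = m<r
  ... | no  m≮r = ⊥-elim (n≮0 (subst (n <_) (extend-≥ 0 lam (≮⇒≥ m≮r)) n<lam))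

  Boxℕ⇒col< : ∀ {m n} → Boxℕ m n → n < c
  Boxℕ⇒col< {m} (_ , n<lam) = <-≤-trans n<lam (extend-all (_≤ c) z≤n lam≤c m)

  Boxℕ⇒Box-fromℕ< : ∀ {m n} (box : Boxℕ m n) → Box D (fromℕ< (Boxℕ⇒row< box)) (fromℕ< (Boxℕ⇒col< box))
  Boxℕ⇒Box-fromℕ< box = Boxℕ⇒Box (subst₂ Boxℕ (sym (toℕ-fromℕ< _)) (sym (toℕ-fromℕ< _)) box)

  module Components (hasRowsCols : HasRowsCols D) where

    row-nonempty : ∀ {m} → m < r → Boxℕ m (muℕ m)
    row-nonempty {m} m<r with proj₁ hasRowsCols (fromℕ< m<r)
    ... | j , box with Box⇒Boxℕ box
    ...   | mu≤j , j<lam = ≤-refl , subst (λ x → muℕ x < lamℕ x) (toℕ-fromℕ< m<r) (≤-<-trans mu≤j j<lam)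

    attached-link : ∀ {m} → Attached (suc m) → (1+m<r : suc m < r) →
                    Conn (Box D) (inj₁ (fromℕ< 1+m<r)) (inj₁ (fromℕ< (<-trans (n<1+n m) 1+m<r)))
    attached-link {m} att 1+m<r =
      stepxy (Boxℕ⇒Box-fromℕ< (attached⇒Boxℕ att))
             (stepyx (Boxℕ⇒Box-fromℕ< (row-nonempty (<-trans (n<1+n m) 1+m<r))) here)

    conn-headRow : ∀ m (m<r : m < r) (h<r : headRow m < r) →
                   Conn (Box D) (inj₁ (fromℕ< m<r)) (inj₁ (fromℕ< h<r))
    conn-headRow zero    _     _   = here
    conn-headRow (suc m) 1+m<r h<r with attached? (suc m)
    ... | yes att = Conn-trans (attached-link att 1+m<r) (conn-headRow m (<-trans (n<1+n m) 1+m<r) h<r)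
    ... | no  _   = here

    rowOf : Vertex r c → Fin r
    rowOf (inj₁ i) = i
    rowOf (inj₂ j) = proj₁ (proj₂ hasRowsCols j)

    conn-rowOf : ∀ v → Conn (Box D) v (inj₁ (rowOf v))
    conn-rowOf (inj₁ i) = here
    conn-rowOf (inj₂ j) = stepyx (proj₂ (proj₂ hasRowsCols j)) here

    headRow<r : ∀ (i : Fin r) → headRow (toℕ i) < r
    headRow<r i = ≤-<-trans (headRow-≤ (toℕ i)) (toℕ<n i)

    componentHead : Vertex r c → Fin r
    componentHead v = fromℕ< (headRow<r (rowOf v))

    conn-componentHead : ∀ v → Conn (Box D) v (inj₁ (componentHead v))
    conn-componentHead v = Conn-trans (conn-rowOf v)
      (subst (λ i → Conn (Box D) (inj₁ i) (inj₁ (componentHead v))) (fromℕ<-toℕ (rowOf v) (toℕ<n (rowOf v)))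
             (conn-headRow (toℕ (rowOf v)) (toℕ<n (rowOf v)) (headRow<r (rowOf v))))

    componentHead-unattached : ∀ v → ¬ Attached (toℕ (componentHead v))
    componentHead-unattached v =
      subst (¬_ ∘ Attached) (sym (toℕ-fromℕ< _)) (headRow-unattached (toℕ (rowOf v)))

    components≤unattachedRows : ∀ {k} → NumComponents D k →
                                k ≤ count (λ (i : Fin r) → ¬? (attached? (toℕ i)))
    components≤unattachedRows (rep , disjoint , _) =
      injective⇒≤count (λ i → ¬? (attached? (toℕ i))) (componentHead ∘ rep) head-injective
                       (componentHead-unattached ∘ rep)
      where
      head-injective : Injective _≡_ _≡_ (componentHead ∘ rep)
      head-injective {a} {b} same = disjoint a b (Conn-trans (conn-componentHead (rep a))
        (subst (λ i → Conn (Box D) (inj₁ i) (rep b)) (sym same) (Conn-sym (conn-componentHead (rep b)))))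

  module Forest {F : Subgraph r c} (F⊆D : IsSubgraphOf F D) (noncrossing : Noncrossing F) where

    edgeℕ : ℕ → ℕ → Bool
    edgeℕ m n = extend false (λ i → extend false (F i) n) m

    Edgeℕ : ℕ → ℕ → Set
    Edgeℕ m n = edgeℕ m n ≡ true

    Edgeℕ? : Binary.Decidable Edgeℕ
    Edgeℕ? m n = edgeℕ m n Bool.≟ true

    edgeℕ-toℕ : ∀ i j → edgeℕ (toℕ i) (toℕ j) ≡ F i j
    edgeℕ-toℕ i j = trans (extend-toℕ false _ i) (extend-toℕ false (F i) j)

    Edgeℕ⇒Edge : ∀ {m n} → Edgeℕ m n → ∃₂ λ i j → toℕ i ≡ m × toℕ j ≡ n × Edge F i j
    Edgeℕ⇒Edge e with extend-nondefault _ e (λ ())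
    ... | i , toℕi≡m , e′ with extend-nondefault (F i) e′ (λ ())
    ...   | j , toℕj≡n , Fij = i , j , toℕi≡m , toℕj≡n , Fij

    Edgeℕ⇒Boxℕ : ∀ {m n} → Edgeℕ m n → Boxℕ m n
    Edgeℕ⇒Boxℕ e with Edgeℕ⇒Edge e
    ... | i , j , refl , refl , Fij = Box⇒Boxℕ (F⊆D i j Fij)

    northwestFree : NorthwestFree Edgeℕ
    northwestFree e e′ m′<m n′<n with Edgeℕ⇒Edge e | Edgeℕ⇒Edge e′
    ... | i , j , refl , refl , Fij | i′ , j′ , refl , refl , Fi′j′ =
      noncrossing⇒no-northwest noncrossing Fij Fi′j′ m′<m n′<n

    open Edges Edgeℕ? Edgeℕ⇒Boxℕ northwestFree public

    topEdgesIn : Fin c → ℕ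
    topEdgesIn j = count (λ (i : Fin r) → topEdge? (toℕ i) (toℕ j))

    stepEdgesIn : Fin r → ℕ
    stepEdgesIn i = count (λ (j : Fin c) → stepEdge? (toℕ i) (toℕ j))

    unattachedRow : Fin r → ℕ
    unattachedRow i = indicator (does (¬? (attached? (toℕ i))))

    numEdges≡top+step : numEdges F ≡ sum topEdgesIn + sum stepEdgesIn
    numEdges≡top+step = begin
      numEdges F
        ≡⟨ sumℕ≡sum r _ ⟩
      sum (λ i → sumℕ c (λ j → if F i j then 1 else 0))
        ≡⟨ sum-cong-≗ (λ i → trans (sumℕ≡sum c _) (sum-cong-≗ (split i))) ⟩
      sum (λ i → sum (λ j → T i j + S i j))
        ≡⟨ sum-cong-≗ (λ i → ∑-distrib-+ (T i) (S i)) ⟩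
      sum (λ i → sum (T i) + stepEdgesIn i)
        ≡⟨ ∑-distrib-+ (sum ∘ T) stepEdgesIn ⟩
      sum (λ i → sum (T i)) + sum stepEdgesIn
        ≡⟨ cong (_+ sum stepEdgesIn) (∑-comm T) ⟩
      sum topEdgesIn + sum stepEdgesIn ∎
      where
      open ≡-Reasoning
      T S : Fin r → Fin c → ℕ
      T i j = indicator (does (topEdge? (toℕ i) (toℕ j)))
      S i j = indicator (does (stepEdge? (toℕ i) (toℕ j)))
      split : ∀ i j → (if F i j then 1 else 0) ≡ T i j + S i j
      split i j = begin
        (if F i j then 1 else 0)
          ≡⟨ if-indicator (F i j) ⟩
        indicator (does (F i j Bool.≟ true))
          ≡⟨ cong (λ b → indicator (does (b Bool.≟ true))) (sym (edgeℕ-toℕ i j)) ⟩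
        indicator (does (Edgeℕ? (toℕ i) (toℕ j)))
          ≡⟨ indicator-split (Edgeℕ? (toℕ i) (toℕ j)) (edgeAbove? (toℕ i) (toℕ j)) ⟩
        T i j + S i j ∎

    topEdgesIn≤1 : ∀ j → topEdgesIn j ≤ 1
    topEdgesIn≤1 j = count≤1 (λ (i : Fin r) → topEdge? (toℕ i) (toℕ j))
                             (λ top top′ → toℕ-injective (topEdge-unique top top′))

    stepEdgesIn+unattachedRow≤1 : ∀ i → stepEdgesIn i + unattachedRow i ≤ 1
    stepEdgesIn+unattachedRow≤1 i with attached? (toℕ i)
    ... | yes _ = subst (_≤ 1) (sym (+-identityʳ _))
                        (count≤1 (λ (j : Fin c) → stepEdge? (toℕ i) (toℕ j))
                                 (λ s s′ → toℕ-injective (stepEdge-unique s s′)))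
    ... | no unattached = ≤-reflexive (cong (_+ 1)
            (count≡0 (λ (j : Fin c) → stepEdge? (toℕ i) (toℕ j)) (λ j s → unattached (stepEdge⇒attached s))))

    module Saturated (hasRowsCols : HasRowsCols D) {k} (components : NumComponents D k)
                     (size : numEdges F ≡ (r + c) ∸ k) where

      saturated : (∀ j → 1 ≤ topEdgesIn j) × (∀ i → 1 ≤ stepEdgesIn i + unattachedRow i)
      saturated = ∑-tight topEdgesIn≤1 (subst (_≤ sum topEdgesIn) (sym (∑-const-1 c)) (proj₁ bounds)) ,
                  ∑-tight stepEdgesIn+unattachedRow≤1 (subst (_≤ sum rowTerms) (sym (∑-const-1 r)) (proj₂ bounds))
        where
        open Components hasRowsCols
        rowTerms : Fin r → ℕ
        rowTerms i = stepEdgesIn i + unattachedRow i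
        c+r≤total : c + r ≤ sum topEdgesIn + sum rowTerms
        c+r≤total = begin
          c + r
            ≡⟨ +-comm c r ⟩
          r + c
            ≤⟨ m≤n+m∸n (r + c) k ⟩
          k + ((r + c) ∸ k)
            ≤⟨ +-monoˡ-≤ _ (components≤unattachedRows components) ⟩
          sum unattachedRow + ((r + c) ∸ k)
            ≡⟨ cong (λ e → sum unattachedRow + e) (trans (sym size) numEdges≡top+step) ⟩
          sum unattachedRow + (sum topEdgesIn + sum stepEdgesIn)
            ≡⟨ solve 3 (λ u t s → u :+ (t :+ s) := t :+ (s :+ u)) refl
                       (sum unattachedRow) (sum topEdgesIn) (sum stepEdgesIn) ⟩
          sum topEdgesIn + (sum stepEdgesIn + sum unattachedRow)
            ≡⟨ cong (λ e → sum topEdgesIn + e) (sym (∑-distrib-+ stepEdgesIn unattachedRow)) ⟩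
          sum topEdgesIn + sum rowTerms ∎
          where
          open ≤-Reasoning
          open ℕ.+-*-Solver
        bounds : c ≤ sum topEdgesIn × r ≤ sum rowTerms
        bounds = +-tight (≤-trans (∑-mono-≤ topEdgesIn≤1) (≤-reflexive (∑-const-1 c)))
                         (≤-trans (∑-mono-≤ stepEdgesIn+unattachedRow≤1) (≤-reflexive (∑-const-1 r)))
                         c+r≤total

      column-has-topEdge : ∀ j → ∃ λ t → TopEdge t (toℕ j)
      column-has-topEdge j =
        let i , top = count>0⇒∃ (λ (i : Fin r) → topEdge? (toℕ i) (toℕ j)) (proj₁ saturated j)
        in  toℕ i , top

      attached-row-has-stepEdge : ∀ i → Attached (toℕ i) → ∃ λ n → StepEdge (toℕ i) n
      attached-row-has-stepEdge i att with attached? (toℕ i) | proj₂ saturated i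
      ... | no unattached | _ = ⊥-elim (unattached att)
      ... | yes _ | 1≤steps+0 =
        let j , s = count>0⇒∃ (λ (j : Fin c) → stepEdge? (toℕ i) (toℕ j)) (subst (1 ≤_) (+-identityʳ _) 1≤steps+0)
        in  toℕ j , s

      top : ℕ → ℕ
      top = choose {P = λ n t → TopEdge t n} column-has-topEdge

      top-edge : ∀ {m n} → Boxℕ m n → TopEdge (top n) n
      top-edge box = choose-spec {P = λ n t → TopEdge t n} column-has-topEdge (Boxℕ⇒col< box)

      row-stepEdge : ∀ i → ∃ λ n → Attached (toℕ i) → StepEdge (toℕ i) n
      row-stepEdge i = dec-choice (attached? (toℕ i)) (attached-row-has-stepEdge i)

      step : ℕ → ℕ
      step = choose {P = λ m n → Attached m → StepEdge m n} row-stepEdge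

      step-edge : ∀ {m} → Attached m → StepEdge m (step m)
      step-edge {suc m} att =
        choose-spec {P = λ m n → Attached m → StepEdge m n} row-stepEdge (Boxℕ⇒row< (attached⇒Boxℕ att)) att

      open Potential step step-edge using (U; G; slack-on-edge; slack-off-edge)

      rowPotential : Fin r → ℤ
      rowPotential i = U (toℕ i)

      colPotential : Fin c → ℤ
      colPotential j = G (toℕ j) (top (toℕ j))

      potential-on-edge : ∀ {i j} → Edge F i j → rowPotential i ℤ.- colPotential j ≡ ℤ.- + (toℕ i * toℕ j)
      potential-on-edge {i} {j} Fij = slack-on-edge E (top-edge (Edgeℕ⇒Boxℕ E))
        where
        E : Edgeℕ (toℕ i) (toℕ j)
        E = trans (edgeℕ-toℕ i j) Fij

      potential-off-edge : ∀ {i j} → Box D i j → ¬ Edge F i j →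
                           ℤ.- + (toℕ i * toℕ j) ℤ.< rowPotential i ℤ.- colPotential j
      potential-off-edge {i} {j} box ¬Fij =
        slack-off-edge (Box⇒Boxℕ box) (¬Fij ∘ trans (sym (edgeℕ-toℕ i j))) (top-edge (Box⇒Boxℕ box))

mainTheorem3 : (r c : ℕ) (D : SkewDiagram r c) → HasRowsCols D →
    (k : ℕ) → NumComponents D k →
    IsRegularTriangulation (r + c) (EdgeOf D) (edgeOfPoint D)
      (NCACell D k) (ncaCellVert D k)
mainTheorem3 r c D hasRowsCols k components = height , cell-affine
  where
  height : EdgeOf D → ℚ
  height ((i , j) , _) = fromℤ (ℤ.- + (toℕ i * toℕ j))

  cell-affine : ∀ σ → Σ (Fin (r + c) → ℚ) λ w → Σ ℚ λ t → ∀ v →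
    (ncaCellVert D k σ v → affine w t (edgeOfPoint D v) ≡ height v) ×
    (¬ ncaCellVert D k σ v → height v ℚ.< affine w t (edgeOfPoint D v))
  cell-affine (F , (F⊆D , _) , noncrossing , _ , size) =
    (fromℤ ∘ rowPotential) ++ (fromℤ ∘ colPotential) , 0ℚ , λ { ((i , j) , box) →
      (λ Fij → trans (affine-potential rowPotential colPotential i j) (cong fromℤ (potential-on-edge Fij))) ,
      (λ ¬Fij → subst (height ((i , j) , box) ℚ.<_) (sym (affine-potential rowPotential colPotential i j))
                      (fromℤ-mono-< (potential-off-edge box ¬Fij))) }
    where
    open Diagram D
    open Forest F⊆D noncrossing
    open Saturated hasRowsCols components size
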